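{- Let $S$ be a finite ranked poset and $\mathcal{M}$ an acyclic matching on $S$. Let $x\in S$ be $\mathcal{M}$-critical with $\operatorname{rk}(x)=q$, and let $z\in S$ with $\operatorname{rk}(z)=q-1$ be such that $(z,y')\in\mathcal{M}$ for some $y'$. Then $\sum_{y\in\nabla(z)}\ell^{(\mathcal{M})}_{(x,y)}=0$ in $\mathbb{Z}_2$.
   Context: A ranked poset is a poset with a rank function $\operatorname{rk}$ such that if $y$ covers $x$ then $\operatorname{rk}(y)=\operatorname{rk}(x)+1$ (and $x<y$ implies $\operatorname{rk}(x)<\operatorname{rk}(y)$). $\nabla(z)$ is the set of elements covering $z$. A matching on $S$ is a set $\mathcal{M}$ of ordered pairs $(a,b)$ with $b$ covering $a$, each element in at most one pair. An $\mathcal{M}$-path is a sequence $y_0,x_1,y_1,\ldots,x_r,y_r$ ($r\geq0$) with $(x_i,y_i)\in\mathcal{M}$, $y_{i-1}$ covering $x_i$, $y_{i-1}\neq y_i$; its initial element is $y_0$ and terminal element $y_r$ (for $r=0$ it is the trivial path consisting of $y_0$). $\mathcal{M}$ is acyclic if no $\mathcal{M}$-path has $r>0$ and $y_r=y_0$. An element is $\mathcal{M}$-critical if it lies in no pair of $\mathcal{M}$. For $x,y$ of equal rank, $\ell^{(\mathcal{M})}_{(x,y)}\in\mathbb{Z}_2$ is the number of $\mathcal{M}$-paths from $x$ to $y$ (initial element $x$, terminal element $y$) modulo $2$. -}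

module Defs where

open import Level using (0ℓ)
open import Data.Nat using (ℕ; zero; suc; _+_; _*_; _%_) renaming (_<_ to _<ℕ_)
open import Data.Bool using (Bool; true; false)
open import Data.Fin using (Fin)
open import Data.Fin.Properties using (all?) renaming (_≟_ to _≟F_)
open import Data.List using (map; allFin)
open import Data.Nat.ListAction using (sum)
open import Data.Product using (_×_; _,_; proj₁; proj₂)
open import Data.Sum using (_⊎_)
open import Relation.Nullary using (¬_; Dec; yes; no)
open import Relation.Nullary.Decidable using (_×-dec_; ¬?; ⌊_⌋)
open import Relation.Binary using (IsDecPartialOrder)
open import Relation.Binary.PropositionalEquality using (_≡_; _≢_)

Σ[_] : ∀ {n} → (Fin n → ℕ) → ℕ
Σ[_] {n} f = sum (map f (allFin n))

[_] : ∀ {p} {P : Set p} → Dec P → ℕ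
[ yes _ ] = 1
[ no  _ ] = 0

record FinRankedPoset (n : ℕ) : Set₁ where
  field
    _≤_   : Fin n → Fin n → Set
    isDecPartialOrder : IsDecPartialOrder _≡_ _≤_

  open IsDecPartialOrder isDecPartialOrder public using () renaming (_≤?_ to _≤?_)

  _<_ : Fin n → Fin n → Set
  x < y = x ≤ y × x ≢ y

  _<?_ : ∀ x y → Dec (x < y)
  x <? y = (x ≤? y) ×-dec ¬? (x ≟F y)

  _⋖_ : Fin n → Fin n → Set
  x ⋖ y = x < y × (∀ w → ¬ (x < w × w < y))

  _⋖?_ : ∀ x y → Dec (x ⋖ y)
  x ⋖? y = (x <? y) ×-dec all? (λ w → ¬? ((x <? w) ×-dec (w <? y)))

  field
    rk : Fin n → ℕ
    rk-cover : ∀ {x y} → x ⋖ y → rk y ≡ suc (rk x)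
    rk-mono  : ∀ {x y} → x < y → rk x <ℕ rk y

module _ {n : ℕ} (S : FinRankedPoset n) where
  open FinRankedPoset S

  record IsMatching (M : Fin n → Fin n → Bool) : Set where
    field
      pair-cover : ∀ {a b} → M a b ≡ true → a ⋖ b
      -- each element lies in at most one pair
      disjoint : ∀ {a b a' b'} → M a b ≡ true → M a' b' ≡ true →
                 (a ≡ a' ⊎ a ≡ b' ⊎ b ≡ a' ⊎ b ≡ b') → (a ≡ a' × b ≡ b')

  module _ (M : Fin n → Fin n → Bool) where

    -- MPath x y r : an M-path y₀ = x, x₁, y₁, …, x_r, y_r = y with r steps.
    -- A step from the current y_{i-1} goes to a pair (x_i , y_i) ∈ M
    -- with y_{i-1} covering x_i and y_{i-1} ≠ y_i.
    data MPath (x : Fin n) : Fin n → ℕ → Set where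
      trivial : MPath x x 0
      step    : ∀ {a b y r} → a ⋖ x → M a b ≡ true → x ≢ b →
                MPath b y r → MPath x y (suc r)

    Acyclic : Set
    Acyclic = ∀ x r → ¬ MPath x x (suc r)

    Critical : Fin n → Set
    Critical x = ∀ a → M a x ≡ false × M x a ≡ false

    count : ℕ → Fin n → Fin n → ℕ
    count zero    x y = [ x ≟F y ]
    count (suc r) x y =
      Σ[ (λ a → Σ[ (λ b →
           [ (a ⋖? x) ×-dec (M a b Data.Bool.≟ true) ×-dec ¬? (x ≟F b) ]
           * count r b y) ]) ]

    -- ℓ_(x,y) ∈ ℤ₂ (as 0/1): number of M-paths from x to y, mod 2.
    -- For an acyclic matching every M-path has fewer than n steps
    -- (its elements y₀,…,y_r are pairwise distinct), so summing r < n
    -- counts all M-paths.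
    ℓ : Fin n → Fin n → ℕ
    ℓ x y = Σ[ (λ (r : Fin n) → count (Data.Fin.toℕ r) x y) ] % 2

-- Every M-path from the critical element x stays at rank q, so it avoids z, and acyclicity makes
-- its vertices distinct; hence it has fewer than n − 1 steps, so truncating at fewer than n steps
-- (as ℓ does) loses no path, even after a step is appended.  Let y' be the partner of z.  The
-- trivial path does not end at y' because x is critical, and every other path to y' ends with the
-- pair (z , y'); so the paths to y' are exactly the one-step extensions of the paths to the
-- elements w ∈ ∇(z) other than y'.  Summing over ∇(z) therefore counts the paths to y' twice.
module Submission where

open import Defs
open import Data.Nat using (ℕ; zero; suc; _+_; _*_; _%_; _<_; _<?_; s≤s; NonZero)
open import Data.Nat.Properties
open import Data.Nat.DivMod using (%-distribˡ-+; %-distribˡ-*; m%n%n≡m%n; m*n%n≡0)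
open import Data.Bool using (Bool; true)
import Data.Bool as Bool
open import Data.Fin using (Fin; zero; suc; toℕ; punchIn; punchOut; inject₁; fromℕ) renaming (_≟_ to _≟F_)
open import Data.Fin.Properties using (pigeonhole; punchOut-injective; punchInᵢ≢i; toℕ-inject₁; toℕ-fromℕ)
open import Data.List using (tabulate)
import Data.List.Properties as List
import Data.Nat.ListAction as List
open import Data.Product using (Σ; _×_; _,_; proj₁)
open import Data.Sum using (inj₂)
open import Function using (_∘_; id)
open import Relation.Nullary using (¬_; Dec; yes; no; contradiction)
open import Relation.Nullary.Decidable using (_×-dec_; ¬?)
open import Relation.Binary.PropositionalEquality hiding ([_])
open import Algebra.Properties.Semiring.Sum +-*-semiring
  using (sum; sum-syntax; sum-cong-≗; sum-replicate-zero; sum-remove; sum-init-last; ∑-comm; ∑-distrib-+;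
         *-distribˡ-sum; *-distribʳ-sum)
open ≡-Reasoning

Σ[]≡∑ : ∀ {n} (f : Fin n → ℕ) → Σ[ f ] ≡ ∑[ i < n ] f i
Σ[]≡∑ f = trans (cong List.sum (List.map-tabulate id f)) (sum-tabulate f)
  where
  sum-tabulate : ∀ {n} (f : Fin n → ℕ) → List.sum (tabulate f) ≡ sum f
  sum-tabulate {zero}  f = refl
  sum-tabulate {suc n} f = cong (f zero +_) (sum-tabulate (f ∘ suc))

∑-zero : ∀ {n} {f : Fin n → ℕ} → (∀ i → f i ≡ 0) → ∑[ i < n ] f i ≡ 0
∑-zero {n} f≗0 = trans (sum-cong-≗ f≗0) (sum-replicate-zero n)

∑-single : ∀ {n} (f : Fin n → ℕ) (j : Fin n) → (∀ i → i ≢ j → f i ≡ 0) → ∑[ i < n ] f i ≡ f j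
∑-single {suc n} f j vanishes = begin
  sum f                          ≡⟨ sum-remove {i = j} f ⟩
  f j + sum (f ∘ punchIn j)      ≡⟨ cong (f j +_) (∑-zero (λ i → vanishes (punchIn j i) (punchInᵢ≢i j i))) ⟩
  f j + 0                        ≡⟨ +-identityʳ (f j) ⟩
  f j                            ∎

∑-%-cong : ∀ {n} d .{{_ : NonZero d}} (f g : Fin n → ℕ) →
           (∀ i → f i % d ≡ g i % d) → (∑[ i < n ] f i) % d ≡ (∑[ i < n ] g i) % d
∑-%-cong {zero}  d f g f≈g = refl
∑-%-cong {suc n} d f g f≈g = begin
  (f zero + sum (f ∘ suc)) % d                ≡⟨ %-distribˡ-+ (f zero) _ d ⟩
  (f zero % d + sum (f ∘ suc) % d) % d
    ≡⟨ cong₂ (λ a b → (a + b) % d) (f≈g zero) (∑-%-cong d (f ∘ suc) (g ∘ suc) (f≈g ∘ suc)) ⟩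
  (g zero % d + sum (g ∘ suc) % d) % d        ≡⟨ %-distribˡ-+ (g zero) _ d ⟨
  (g zero + sum (g ∘ suc)) % d                ∎

m*[n%d]%d≡m*n%d : ∀ m n d .{{_ : NonZero d}} → (m * (n % d)) % d ≡ (m * n) % d
m*[n%d]%d≡m*n%d m n d = begin
  (m * (n % d)) % d              ≡⟨ %-distribˡ-* m (n % d) d ⟩
  ((m % d) * (n % d % d)) % d    ≡⟨ cong (λ t → ((m % d) * t) % d) (m%n%n≡m%n n d) ⟩
  ((m % d) * (n % d)) % d        ≡⟨ %-distribˡ-* m n d ⟨
  (m * n) % d                    ∎

[m+m]%2≡0 : ∀ m → (m + m) % 2 ≡ 0
[m+m]%2≡0 m = begin
  (m + m) % 2    ≡⟨ cong (λ t → (m + t) % 2) (+-identityʳ m) ⟨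
  (2 * m) % 2    ≡⟨ cong (_% 2) (*-comm 2 m) ⟩
  (m * 2) % 2    ≡⟨ m*n%n≡0 m 2 ⟩
  0              ∎

[]-yes : ∀ {P : Set} (P? : Dec P) → P → [ P? ] ≡ 1
[]-yes (yes _) _ = refl
[]-yes (no ¬p) p = contradiction p ¬p

[]-no : ∀ {P : Set} (P? : Dec P) → ¬ P → [ P? ] ≡ 0
[]-no (yes p) ¬p = contradiction p ¬p
[]-no (no _)  _  = refl

[]-×-dec : ∀ {P Q : Set} (P? : Dec P) (Q? : Dec Q) → [ P? ×-dec Q? ] ≡ [ P? ] * [ Q? ]
[]-×-dec (yes _) (yes _) = refl
[]-×-dec (yes _) (no _)  = refl
[]-×-dec (no _)  _       = refl

[¬?]+[]≡1 : ∀ {P : Set} (P? : Dec P) → [ ¬? P? ] + [ P? ] ≡ 1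
[¬?]+[]≡1 (yes _) = refl
[¬?]+[]≡1 (no _)  = refl

∑-split-at : ∀ {n} (j : Fin n) (f : Fin n → ℕ) →
             ∑[ i < n ] f i ≡ ∑[ i < n ] ([ ¬? (i ≟F j) ] * f i) + f j
∑-split-at {n} j f = begin
  ∑[ i < n ] f i                                                ≡⟨ sum-cong-≗ split ⟩
  ∑[ i < n ] ([ ¬? (i ≟F j) ] * f i + [ i ≟F j ] * f i)
    ≡⟨ ∑-distrib-+ (λ i → [ ¬? (i ≟F j) ] * f i) (λ i → [ i ≟F j ] * f i) ⟩
  off-j + ∑[ i < n ] ([ i ≟F j ] * f i)
    ≡⟨ cong (off-j +_) (∑-single _ j (λ i i≢j → cong (_* f i) ([]-no (i ≟F j) i≢j))) ⟩
  off-j + [ j ≟F j ] * f j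
    ≡⟨ cong (λ t → off-j + t * f j) ([]-yes (j ≟F j) refl) ⟩
  off-j + 1 * f j                                               ≡⟨ cong (off-j +_) (*-identityˡ (f j)) ⟩
  off-j + f j                                                   ∎
  where
  off-j : ℕ
  off-j = ∑[ i < n ] ([ ¬? (i ≟F j) ] * f i)

  split : ∀ i → f i ≡ [ ¬? (i ≟F j) ] * f i + [ i ≟F j ] * f i
  split i = begin
    f i                                           ≡⟨ *-identityˡ (f i) ⟨
    1 * f i                                       ≡⟨ cong (_* f i) ([¬?]+[]≡1 (i ≟F j)) ⟨
    ([ ¬? (i ≟F j) ] + [ i ≟F j ]) * f i          ≡⟨ *-distribʳ-+ (f i) [ ¬? (i ≟F j) ] [ i ≟F j ] ⟩
    [ ¬? (i ≟F j) ] * f i + [ i ≟F j ] * f i      ∎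

module MatrixPower {n : ℕ} (T : Fin n → Fin n → ℕ) where

  power : ℕ → Fin n → Fin n → ℕ
  power zero    x y = [ x ≟F y ]
  power (suc r) x y = ∑[ w < n ] (T x w * power r w y)

  power-suc-last : ∀ r x y → power (suc r) x y ≡ ∑[ w < n ] (power r x w * T w y)
  power-suc-last zero x y = trans right-unit (sym left-unit)
    where
    right-unit : ∑[ w < n ] (T x w * [ w ≟F y ]) ≡ T x y
    right-unit = begin
      ∑[ w < n ] (T x w * [ w ≟F y ])
        ≡⟨ ∑-single (λ w → T x w * [ w ≟F y ]) y
                    (λ w w≢y → trans (cong (T x w *_) ([]-no (w ≟F y) w≢y)) (*-zeroʳ (T x w))) ⟩
      T x y * [ y ≟F y ]     ≡⟨ cong (T x y *_) ([]-yes (y ≟F y) refl) ⟩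
      T x y * 1              ≡⟨ *-identityʳ (T x y) ⟩
      T x y                  ∎
    left-unit : ∑[ w < n ] ([ x ≟F w ] * T w y) ≡ T x y
    left-unit = begin
      ∑[ w < n ] ([ x ≟F w ] * T w y)
        ≡⟨ ∑-single (λ w → [ x ≟F w ] * T w y) x
                    (λ w w≢x → cong (_* T w y) ([]-no (x ≟F w) (w≢x ∘ sym))) ⟩
      [ x ≟F x ] * T x y     ≡⟨ cong (_* T x y) ([]-yes (x ≟F x) refl) ⟩
      1 * T x y              ≡⟨ *-identityˡ (T x y) ⟩
      T x y                  ∎
  power-suc-last (suc r) x y = begin
    ∑[ w < n ] (T x w * power (suc r) w y)
      ≡⟨ sum-cong-≗ (λ w → cong (T x w *_) (power-suc-last r w y)) ⟩
    ∑[ w < n ] (T x w * ∑[ v < n ] (power r w v * T v y))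
      ≡⟨ sum-cong-≗ (λ w → *-distribˡ-sum (T x w) (λ v → power r w v * T v y)) ⟩
    ∑[ w < n ] ∑[ v < n ] (T x w * (power r w v * T v y))
      ≡⟨ sum-cong-≗ (λ w → sum-cong-≗ (λ v → *-assoc (T x w) (power r w v) (T v y))) ⟨
    ∑[ w < n ] ∑[ v < n ] (T x w * power r w v * T v y)
      ≡⟨ ∑-comm (λ w v → T x w * power r w v * T v y) ⟩
    ∑[ v < n ] ∑[ w < n ] (T x w * power r w v * T v y)
      ≡⟨ sum-cong-≗ (λ v → *-distribʳ-sum (T v y) (λ w → T x w * power r w v)) ⟨
    ∑[ v < n ] (power (suc r) x v * T v y)
      ∎

module _ {n} {S : FinRankedPoset n} {M : Fin n → Fin n → Bool} where
  open FinRankedPoset S using (rk; rk-cover)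

  vertex : ∀ {x y r} → MPath S M x y r → Fin (suc r) → Fin n
  vertex {x} _              zero    = x
  vertex     (step _ _ _ p) (suc i) = vertex p i

  prefix : ∀ {x y r} (p : MPath S M x y r) (i : Fin (suc r)) → MPath S M x (vertex p i) (toℕ i)
  prefix _                     zero    = trivial
  prefix (step a⋖x Mab x≢b p) (suc i) = step a⋖x Mab x≢b (prefix p i)

  rk-vertex : IsMatching S M → ∀ {x y r} (p : MPath S M x y r) i → rk (vertex p i) ≡ rk x
  rk-vertex _        _                    zero    = refl
  rk-vertex matching (step a⋖x Mab _ p) (suc i) = begin
    rk (vertex p i)    ≡⟨ rk-vertex matching p i ⟩
    rk _               ≡⟨ rk-cover (IsMatching.pair-cover matching Mab) ⟩
    suc (rk _)         ≡⟨ rk-cover a⋖x ⟨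
    rk _               ∎

  acyclic⇒vertices-distinct : Acyclic S M → ∀ {x y r} (p : MPath S M x y r) {i j : Fin (suc r)} →
                              toℕ i < toℕ j → vertex p i ≢ vertex p j
  acyclic⇒vertices-distinct acyclic p@(step _ _ _ _) {zero} {suc j} _ x≡vⱼ =
    acyclic _ (toℕ j) (subst (λ v → MPath S M _ v (suc (toℕ j))) (sym x≡vⱼ) (prefix p (suc j)))
  acyclic⇒vertices-distinct acyclic (step _ _ _ p) {suc i} {suc j} (s≤s i<j) =
    acyclic⇒vertices-distinct acyclic p i<j

acyclic⇒avoiding-path-short : ∀ {m} {S : FinRankedPoset (suc m)} {M} → Acyclic S M →
                              ∀ {x y r} (p : MPath S M x y r) {z} → (∀ i → z ≢ vertex p i) → r < m
acyclic⇒avoiding-path-short {m} acyclic {r = r} p z∉p with r <? m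
... | yes r<m = r<m
... | no r≮m with pigeonhole (s≤s (≮⇒≥ r≮m)) (λ i → punchOut (z∉p i))
...   | i , j , i<j , same =
  contradiction (punchOut-injective (z∉p i) (z∉p j) same) (acyclic⇒vertices-distinct acyclic p i<j)

module Counting {n} (S : FinRankedPoset n) (M : Fin n → Fin n → Bool) where
  open FinRankedPoset S using (_⋖_; _⋖?_)

  Step : Fin n → Fin n → Fin n → Set
  Step x a b = a ⋖ x × M a b ≡ true × x ≢ b

  step? : ∀ x a b → Dec (Step x a b)
  step? x a b = (a ⋖? x) ×-dec (M a b Bool.≟ true) ×-dec ¬? (x ≟F b)

  steps : Fin n → Fin n → ℕ
  steps x b = ∑[ a < n ] [ step? x a b ]

  open MatrixPower steps using (power; power-suc-last)

  count-suc : ∀ r x y → count S M (suc r) x y ≡ ∑[ a < n ] ∑[ b < n ] ([ step? x a b ] * count S M r b y)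
  count-suc r x y = begin
    Σ[ (λ a → Σ[ via a ]) ]     ≡⟨ Σ[]≡∑ (λ a → Σ[ via a ]) ⟩
    ∑[ a < n ] Σ[ via a ]       ≡⟨ sum-cong-≗ (λ a → Σ[]≡∑ (via a)) ⟩
    ∑[ a < n ] ∑[ b < n ] via a b  ∎
    where
    via : Fin n → Fin n → ℕ
    via a b = [ step? x a b ] * count S M r b y

  count≡power : ∀ r x y → count S M r x y ≡ power r x y
  count≡power zero    x y = refl
  count≡power (suc r) x y = begin
    count S M (suc r) x y
      ≡⟨ count-suc r x y ⟩
    ∑[ a < n ] ∑[ b < n ] ([ step? x a b ] * count S M r b y)
      ≡⟨ sum-cong-≗ (λ a → sum-cong-≗ (λ b → cong ([ step? x a b ] *_) (count≡power r b y))) ⟩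
    ∑[ a < n ] ∑[ b < n ] ([ step? x a b ] * power r b y)
      ≡⟨ ∑-comm (λ a b → [ step? x a b ] * power r b y) ⟩
    ∑[ b < n ] ∑[ a < n ] ([ step? x a b ] * power r b y)
      ≡⟨ sum-cong-≗ (λ b → *-distribʳ-sum (power r b y) (λ a → [ step? x a b ])) ⟨
    ∑[ b < n ] (steps x b * power r b y)
      ∎

  count-suc-last : ∀ r x y → count S M (suc r) x y ≡ ∑[ w < n ] (count S M r x w * steps w y)
  count-suc-last r x y = begin
    count S M (suc r) x y                      ≡⟨ count≡power (suc r) x y ⟩
    power (suc r) x y                          ≡⟨ power-suc-last r x y ⟩
    ∑[ w < n ] (power r x w * steps w y)       ≡⟨ sum-cong-≗ (λ w → cong (_* steps w y) (count≡power r x w)) ⟨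
    ∑[ w < n ] (count S M r x w * steps w y)   ∎

  ¬MPath⇒count≡0 : ∀ r x y → ¬ MPath S M x y r → count S M r x y ≡ 0
  ¬MPath⇒count≡0 zero    x y no-path = []-no (x ≟F y) (λ { refl → no-path trivial })
  ¬MPath⇒count≡0 (suc r) x y no-path =
    trans (count-suc r x y) (∑-zero (λ a → ∑-zero (no-path-via a)))
    where
    no-path-via : ∀ a b → [ step? x a b ] * count S M r b y ≡ 0
    no-path-via a b with step? x a b
    ... | yes (a⋖x , Mab , x≢b) = trans (*-identityˡ _) (¬MPath⇒count≡0 r b y (no-path ∘ step a⋖x Mab x≢b))
    ... | no _                  = refl

  steps-into-partner : IsMatching S M → ∀ {z y'} → M z y' ≡ true →
                       ∀ w → steps w y' ≡ [ ¬? (w ≟F y') ] * [ z ⋖? w ]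
  steps-into-partner matching {z} {y'} Mzy' w = begin
    ∑[ a < n ] [ step? w a y' ]                                   ≡⟨ ∑-single _ z only-z ⟩
    [ step? w z y' ]                                              ≡⟨ []-×-dec (z ⋖? w) _ ⟩
    [ z ⋖? w ] * [ (M z y' Bool.≟ true) ×-dec ¬? (w ≟F y') ]
      ≡⟨ cong ([ z ⋖? w ] *_) ([]-×-dec (M z y' Bool.≟ true) _) ⟩
    [ z ⋖? w ] * ([ M z y' Bool.≟ true ] * [ ¬? (w ≟F y') ])
      ≡⟨ cong (λ t → [ z ⋖? w ] * (t * [ ¬? (w ≟F y') ])) ([]-yes (M z y' Bool.≟ true) Mzy') ⟩
    [ z ⋖? w ] * (1 * [ ¬? (w ≟F y') ])                           ≡⟨ cong ([ z ⋖? w ] *_) (*-identityˡ _) ⟩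
    [ z ⋖? w ] * [ ¬? (w ≟F y') ]                                 ≡⟨ *-comm [ z ⋖? w ] _ ⟩
    [ ¬? (w ≟F y') ] * [ z ⋖? w ]                                 ∎
    where
    only-z : ∀ a → a ≢ z → [ step? w a y' ] ≡ 0
    only-z a a≢z = []-no (step? w a y') λ (_ , May' , _) →
      a≢z (proj₁ (IsMatching.disjoint matching May' Mzy' (inj₂ (inj₂ (inj₂ refl)))))

module CoveringSum {m} (S : FinRankedPoset (suc m)) (M : Fin (suc m) → Fin (suc m) → Bool)
                   (matching : IsMatching S M) (acyclic : Acyclic S M) {x z y' : Fin (suc m)}
                   (x-critical : Critical S M x)
                   (rk-x : FinRankedPoset.rk S x ≡ suc (FinRankedPoset.rk S z))
                   (Mzy' : M z y' ≡ true) where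
  open FinRankedPoset S using (rk; _⋖?_)
  open Counting S M

  paths : ℕ → Fin (suc m) → ℕ
  paths k w = ∑[ r < k ] count S M (toℕ r) x w

  z∉path : ∀ {w r} (p : MPath S M x w r) i → z ≢ vertex p i
  z∉path p i z≡vᵢ = 1+n≢n (sym (begin
    rk z              ≡⟨ cong rk z≡vᵢ ⟩
    rk (vertex p i)   ≡⟨ rk-vertex matching p i ⟩
    rk x              ≡⟨ rk-x ⟩
    suc (rk z)        ∎))

  no-path-of-length-m : ∀ w → count S M m x w ≡ 0
  no-path-of-length-m w =
    ¬MPath⇒count≡0 m x w (λ p → <-irrefl refl (acyclic⇒avoiding-path-short acyclic p (z∉path p)))

  paths-suc-m≡paths-m : ∀ w → paths (suc m) w ≡ paths m w
  paths-suc-m≡paths-m w = begin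
    paths (suc m) w
      ≡⟨ sum-init-last {m} (λ r → count S M (toℕ r) x w) ⟩
    paths-via-inject₁ + count S M (toℕ (fromℕ m)) x w
      ≡⟨ cong₂ _+_ paths-via-inject₁≡paths-m (cong (λ k → count S M k x w) (toℕ-fromℕ m)) ⟩
    paths m w + count S M m x w
      ≡⟨ cong (paths m w +_) (no-path-of-length-m w) ⟩
    paths m w + 0
      ≡⟨ +-identityʳ (paths m w) ⟩
    paths m w
      ∎
    where
    paths-via-inject₁ : ℕ
    paths-via-inject₁ = ∑[ r < m ] count S M (toℕ (inject₁ r)) x w

    paths-via-inject₁≡paths-m : paths-via-inject₁ ≡ paths m w
    paths-via-inject₁≡paths-m = sum-cong-≗ (λ (r : Fin m) → cong (λ k → count S M k x w) (toℕ-inject₁ r))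

  x≢y' : x ≢ y'
  x≢y' refl with trans (sym Mzy') (proj₁ (x-critical z))
  ... | ()

  paths-to-partner : paths (suc m) y' ≡ ∑[ w < suc m ] ([ ¬? (w ≟F y') ] * ([ z ⋖? w ] * paths m w))
  paths-to-partner = begin
    count S M 0 x y' + ∑[ r < m ] count S M (suc (toℕ r)) x y'
      ≡⟨ cong₂ _+_ ([]-no (x ≟F y') x≢y') last-step-split ⟩
    ∑[ r < m ] ∑[ w < suc m ] (count S M (toℕ r) x w * steps w y')
      ≡⟨ ∑-comm {m} {suc m} (λ r w → count S M (toℕ r) x w * steps w y') ⟩
    ∑[ w < suc m ] ∑[ r < m ] (count S M (toℕ r) x w * steps w y')
      ≡⟨ sum-cong-≗ (λ w → *-distribʳ-sum (steps w y') (λ (r : Fin m) → count S M (toℕ r) x w)) ⟨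
    ∑[ w < suc m ] (paths m w * steps w y')
      ≡⟨ sum-cong-≗ (λ w → cong (paths m w *_) (steps-into-partner matching Mzy' w)) ⟩
    ∑[ w < suc m ] (paths m w * ([ ¬? (w ≟F y') ] * [ z ⋖? w ]))
      ≡⟨ sum-cong-≗ (λ w → rotate (paths m w) [ ¬? (w ≟F y') ] [ z ⋖? w ]) ⟩
    ∑[ w < suc m ] ([ ¬? (w ≟F y') ] * ([ z ⋖? w ] * paths m w))
      ∎
    where
    last-step-split : ∑[ r < m ] count S M (suc (toℕ r)) x y' ≡
                      ∑[ r < m ] ∑[ w < suc m ] (count S M (toℕ r) x w * steps w y')
    last-step-split = sum-cong-≗ (λ (r : Fin m) → count-suc-last (toℕ r) x y')

    rotate : ∀ a b c → a * (b * c) ≡ b * (c * a)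
    rotate a b c = trans (*-comm a (b * c)) (*-assoc b c a)

  covering-sum≡twice : ∑[ w < suc m ] ([ z ⋖? w ] * paths (suc m) w) ≡ paths (suc m) y' + paths (suc m) y'
  covering-sum≡twice = begin
    ∑[ w < suc m ] ([ z ⋖? w ] * paths (suc m) w)
      ≡⟨ sum-cong-≗ (λ w → cong ([ z ⋖? w ] *_) (paths-suc-m≡paths-m w)) ⟩
    ∑[ w < suc m ] ([ z ⋖? w ] * paths m w)
      ≡⟨ ∑-split-at y' (λ w → [ z ⋖? w ] * paths m w) ⟩
    ∑[ w < suc m ] ([ ¬? (w ≟F y') ] * ([ z ⋖? w ] * paths m w)) + [ z ⋖? y' ] * paths m y'
      ≡⟨ cong₂ _+_ (sym paths-to-partner)
                   (cong (_* paths m y') ([]-yes (z ⋖? y') (IsMatching.pair-cover matching Mzy'))) ⟩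
    paths (suc m) y' + 1 * paths m y'
      ≡⟨ cong (paths (suc m) y' +_) (trans (*-identityˡ (paths m y')) (sym (paths-suc-m≡paths-m y'))) ⟩
    paths (suc m) y' + paths (suc m) y'
      ∎

  ℓ≡paths%2 : ∀ w → ℓ S M x w ≡ paths (suc m) w % 2
  ℓ≡paths%2 w = cong (_% 2) (Σ[]≡∑ {suc m} (λ r → count S M (toℕ r) x w))

  covering-sum-ℓ≡covering-sum-paths :
    (∑[ w < suc m ] ([ z ⋖? w ] * ℓ S M x w)) % 2 ≡ (∑[ w < suc m ] ([ z ⋖? w ] * paths (suc m) w)) % 2
  covering-sum-ℓ≡covering-sum-paths =
    ∑-%-cong 2 (λ w → [ z ⋖? w ] * ℓ S M x w) (λ w → [ z ⋖? w ] * paths (suc m) w)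
               (λ w → trans (cong (λ t → ([ z ⋖? w ] * t) % 2) (ℓ≡paths%2 w))
                            (m*[n%d]%d≡m*n%d [ z ⋖? w ] (paths (suc m) w) 2))

lemma3p1 : ∀ {n} (S : FinRankedPoset n) (M : Fin n → Fin n → Bool) →
    IsMatching S M → Acyclic S M →
    ∀ (x z : Fin n) → Critical S M x →
    FinRankedPoset.rk S x ≡ suc (FinRankedPoset.rk S z) →
    Σ (Fin n) (λ y' → M z y' ≡ true) →
    Σ[ (λ y → [ FinRankedPoset._⋖?_ S z y ] * ℓ S M x y) ] % 2 ≡ 0
lemma3p1 {zero}  S M matching acyclic () z x-critical rk-x (y' , Mzy')
lemma3p1 {suc m} S M matching acyclic x z x-critical rk-x (y' , Mzy') = begin
  Σ[ (λ y → [ z ⋖? y ] * ℓ S M x y) ] % 2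
    ≡⟨ cong (_% 2) (Σ[]≡∑ (λ y → [ z ⋖? y ] * ℓ S M x y)) ⟩
  (∑[ y < suc m ] ([ z ⋖? y ] * ℓ S M x y)) % 2       ≡⟨ covering-sum-ℓ≡covering-sum-paths ⟩
  (∑[ y < suc m ] ([ z ⋖? y ] * paths (suc m) y)) % 2  ≡⟨ cong (_% 2) covering-sum≡twice ⟩
  (paths (suc m) y' + paths (suc m) y') % 2            ≡⟨ [m+m]%2≡0 (paths (suc m) y') ⟩
  0                                                    ∎
  where
  open FinRankedPoset S using (_⋖?_)
  open CoveringSum S M matching acyclic x-critical rk-x Mzy'
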